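{- Let $G$ be the graph with vertex set $\{v_n:n\in\mathbb{N}\}\cup\{v_\infty\}$ and edge set $\{v_\infty v_n:n\in\mathbb{N}\}\cup\{v_nv_{n+1}:n\in\mathbb{N}\}$, with weights $c(v_\infty v_n)=1$ for all $n$, and, writing $e_n=v_nv_{n+1}$, $c(e_0)=2$ and $c(e_n)=c(e_{n-1})+n+1$ for $n>0$. Then $(G,c)$ has no Gomory-Hu tree.
   Context: For a vertex set $X$, $d_c(X)$ is the sum of $c(e)$ over edges with exactly one end in $X$. A $u$-$v$ cut is a vertex set containing $u$ but not $v$; $\lambda_c(u,v)=\inf\{d_c(X): X\text{ a }u\text{ - }v\text{ cut}\}$. A Gomory-Hu tree for $(G,c)$ is a tree $T$ on the vertex set of $G$ such that for all distinct vertices $u,v$ there is an edge $e$ of $T$ such that the vertex sets of the two components of $T-e$ separate $u$ and $v$ (one is a $u$-$v$ cut) and have $d_c$-value $\lambda_c(u,v)$. -}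

module Defs where

open import Data.Nat using (ℕ; zero; suc; _+_; _≤_)
open import Data.List using (List; []; _∷_; map)
open import Data.Nat.ListAction using (sum)
open import Data.List.Relation.Unary.All using (All)
open import Data.List.Relation.Unary.Unique.Propositional using (Unique)
open import Data.Product using (Σ; _×_; ∃; ∃-syntax; _,_)
open import Data.Sum using (_⊎_)
open import Relation.Nullary using (¬_)
open import Relation.Binary.PropositionalEquality using (_≡_; _≢_)

data V : Set where
  v  : ℕ → V
  v∞ : V

-- Edges of G: spoke n = v∞ v_n, path n = e_n = v_n v_{n+1}.
data Edge : Set where
  spoke : ℕ → Edge
  path  : ℕ → Edge

end₁ : Edge → V
end₁ (spoke n) = v∞
end₁ (path n)  = v n

end₂ : Edge → V
end₂ (spoke n) = v n
end₂ (path n)  = v (suc n)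

cPath : ℕ → ℕ
cPath zero    = 2
cPath (suc n) = cPath n + suc (suc n)

c : Edge → ℕ
c (spoke n) = 1
c (path n)  = cPath n

-- Cuts and d_c (valued in ℕ ∪ {∞}, described through upper bounds)

VSet : Set₁
VSet = V → Set

Crossing : VSet → Edge → Set
Crossing X e = (X (end₁ e) × ¬ X (end₂ e)) ⊎ (¬ X (end₁ e) × X (end₂ e))

-- d_c(X) ≤ k  (k ∈ ℕ): every finite set of edges crossing X has
-- total weight ≤ k.  d_c(X) = ∞ iff this holds for no k.
DcLe : VSet → ℕ → Set
DcLe X k = (es : List Edge) → Unique es → All (Crossing X) es → sum (map c es) ≤ k

DcLeDc : VSet → VSet → Set
DcLeDc A X = (k : ℕ) → DcLe X k → DcLe A k

Cut : V → V → VSet → Set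
Cut u w X = X u × ¬ X w

-- d_c(A) = λ_c(u,v) for a u-v cut A: d_c(A) is ≤ d_c(X) for all u-v cuts X
-- (A itself being a u-v cut, this is exactly "d_c(A) is the infimum").
AttainsLambda : V → V → VSet → Set₁
AttainsLambda u w A = Cut u w A × ((X : VSet) → Cut u w X → DcLeDc A X)

Rel : Set₁
Rel = V → V → Set

data Chain (E : Rel) : V → List V → Set where
  [-]  : ∀ {x} → Chain E x []
  _∷ᶜ_ : ∀ {x y ys} → E x y → Chain E y ys → Chain E x (y ∷ ys)

last : V → List V → V
last x []       = x
last x (y ∷ ys) = last y ys

IsPath : Rel → V → V → List V → Set
IsPath E x y xs = Chain E x xs × Unique (x ∷ xs) × last x xs ≡ y

HasCycle : Rel → Set
HasCycle E = Σ V λ x → Σ V λ y → Σ V λ z → Σ (List V) λ zs →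
  Chain E x (y ∷ z ∷ zs) × Unique (x ∷ y ∷ z ∷ zs) × E (last z zs) x

record IsTree (E : Rel) : Set where
  field
    symmetric   : ∀ {x y} → E x y → E y x
    irreflexive : ∀ {x} → ¬ E x x
    connected   : ∀ x y → Σ (List V) λ xs → IsPath E x y xs
    acyclic     : ¬ HasCycle E

SameEdge : V → V → V → V → Set
SameEdge a b x y = (x ≡ a × y ≡ b) ⊎ (x ≡ b × y ≡ a)

-- Side E a b x : x lies in the component of a in T - ab
data Side (E : Rel) (a b : V) : V → Set where
  here : Side E a b a
  step : ∀ {y z} → Side E a b y → E y z → ¬ SameEdge a b y z → Side E a b z

IsGomoryHu : Rel → Set₁
IsGomoryHu E = (u w : V) → u ≢ w →
  ∃[ a ] ∃[ b ] (E a b × Side E a b u × Side E b a w × AttainsLambda u w (Side E a b))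

GomoryHuTree : Rel → Set₁
GomoryHuTree E = IsTree E × IsGomoryHu E

-- Let K N = c(e_N) + N + 1, the value of d_c on I_N = {v_0,…,v_N}.  Call A a
-- low cut at level N if v_N ∈ A, v_∞ ∉ A and d_c(A) ≤ K N.  Counting spokes
-- and path edges leaving A shows that such an A
--   (1) misses v_{N+1}: the path leaves A at some e_j, j > N, and c(e_j) > K N;
--   (2) contains v_0,…,v_N: else a last gap v_j below N, the exit e_{j'} above
--       N and the spokes at v_{j+1},…,v_N together cost more than K N.
-- In a Gomory-Hu tree the side S_N of the edge separating v_N from v_∞ is a
-- low cut at level N.  Let N bound the indices on the tree path from v_0 to
-- v_∞.  By (2) both separating edges of S_N and S_{N+1} lie on that path, so
-- their ends are v_∞ or some v_i with i < N; by (2) again S_{N+1} ⊆ S_N,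
-- contradicting (1).  Cuts are arbitrary predicates, so case distinctions
-- are classical and made inside the double-negation monad (the goal ⊥ is
-- stable).

module Submission where

open import Defs
open import Relation.Nullary using (¬_)

open import Data.Nat using (ℕ; zero; suc; _+_; _≤_; _<_; z≤n; s≤s)
open import Data.Nat.Properties
open import Data.List using (List; []; _∷_; _++_; map; applyUpTo)
open import Data.List.Properties using (map-++)
open import Data.Nat.ListAction using (sum)
open import Data.Nat.ListAction.Properties using (sum-++)
open import Data.List.Relation.Unary.All as All using (All; []; _∷_)
open import Data.List.Relation.Unary.All.Properties as Allₚ using ()
open import Data.List.Relation.Unary.Any using (here; there)
open import Data.List.Relation.Unary.AllPairs using ([]; _∷_)
open import Data.List.Relation.Unary.Unique.Propositional using (Unique)
open import Data.List.Relation.Unary.Unique.Propositional.Properties as Uniqueₚ using ()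
open import Data.List.Membership.Propositional using (_∈_)
open import Data.List.Membership.Propositional.Properties
  using (∈-∃++; ∈-++⁻; ∈-++⁺ˡ; ∈-++⁺ʳ; ∈-applyUpTo⁺)
open import Data.List.Relation.Binary.Subset.Propositional using (_⊆_)
open import Data.Product using (Σ; _×_; _,_)
open import Data.Sum using (_⊎_; inj₁; inj₂)
open import Data.Empty using (⊥)
open import Function using (_∘_)
open import Effect.Monad using (RawMonad)
open import Relation.Nullary.Decidable using (Dec; yes; no; map′; _×-dec_; _⊎-dec_; ¬¬-excluded-middle)
open import Relation.Nullary.Negation using (DoubleNegation; ¬¬-Monad; contradiction)
open import Relation.Binary.PropositionalEquality
open import Data.Nat.Solver using (module +-*-Solver)
open import Level using (0ℓ)

open RawMonad (¬¬-Monad {0ℓ})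

module _ {X : Set} (w : X → ℕ) where

  weight : List X → ℕ
  weight xs = sum (map w xs)

  weight-++ : ∀ xs ys → weight (xs ++ ys) ≡ weight xs + weight ys
  weight-++ xs ys = trans (cong sum (map-++ w xs ys)) (sum-++ (map w xs) (map w ys))

  weight-remove : ∀ us x vs → weight (us ++ x ∷ vs) ≡ w x + weight (us ++ vs)
  weight-remove us x vs = begin
    weight (us ++ x ∷ vs)          ≡⟨ weight-++ us (x ∷ vs) ⟩
    weight us + (w x + weight vs)  ≡⟨ sym (+-assoc (weight us) (w x) _) ⟩
    weight us + w x + weight vs    ≡⟨ cong (_+ weight vs) (+-comm (weight us) (w x)) ⟩
    w x + weight us + weight vs    ≡⟨ +-assoc (w x) (weight us) _ ⟩
    w x + (weight us + weight vs)  ≡⟨ cong (w x +_) (sym (weight-++ us vs)) ⟩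
    w x + weight (us ++ vs)        ∎
    where open ≡-Reasoning

  weight-⊆ : ∀ {xs ys} → Unique xs → xs ⊆ ys → weight xs ≤ weight ys
  weight-⊆ {[]}     _            _   = z≤n
  weight-⊆ {x ∷ xs} (x∉xs ∷ uxs) sub with us , vs , refl ← ∈-∃++ (sub (here refl)) =
    ≤-trans (+-monoʳ-≤ (w x) (weight-⊆ uxs remaining))
            (≤-reflexive (sym (weight-remove us x vs)))
    where
    remaining : xs ⊆ us ++ vs
    remaining z∈xs with ∈-++⁻ us (sub (there z∈xs))
    ... | inj₁ z∈us         = ∈-++⁺ˡ z∈us
    ... | inj₂ (here refl)  = contradiction refl (All.lookup x∉xs z∈xs)
    ... | inj₂ (there z∈vs) = ∈-++⁺ʳ us z∈vs

cost : List Edge → ℕ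
cost = weight c

module _ (P : ℕ → Set) where

  Run : ℕ → ℕ → Set
  Run a s = ∀ t → t < s → P (a + t)

  Exit : ℕ → Set
  Exit m = Σ ℕ λ j → m ≤ j × P j × ¬ P (suc j)

  RunEndingAt : ℕ → Set
  RunEndingAt n = Σ ℕ λ j → Σ ℕ λ s → j + suc s ≡ n × ¬ P j × Run (suc j) (suc s)

module _ {P : ℕ → Set} where

  run-first : ∀ {a s} → Run P a (suc s) → P a
  run-first run = subst P (+-identityʳ _) (run 0 (s≤s z≤n))

  run-snoc : ∀ {a s} → Run P a s → P (a + s) → Run P a (suc s)
  run-snoc {s = s} run p t t<1+s with m<1+n⇒m<n∨m≡n t<1+s
  ... | inj₁ t<s  = run t t<s
  ... | inj₂ refl = p

  run-single : ∀ {a} → P a → Run P a 1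
  run-single p zero (s≤s z≤n) = subst P (sym (+-identityʳ _)) p

  exitOrRun : ∀ {m} t → P m → DoubleNegation (Exit P m ⊎ Run P m (suc t))
  exitOrRun zero    pm = pure (inj₂ (run-single pm))
  exitOrRun {m} (suc t) pm = exitOrRun t pm >>= λ where
    (inj₁ exit) → pure (inj₁ exit)
    (inj₂ run)  → ¬¬-excluded-middle >>= λ where
      (yes p) → pure (inj₂ (run-snoc run p))
      (no ¬p) → pure (inj₁ (m + t , m≤m+n m t , run t ≤-refl ,
                              ¬p ∘ subst P (sym (+-suc m t))))

  exit : ∀ {m k} → (∀ {a s} → Run P a s → s ≤ k) → P m → DoubleNegation (Exit P m)
  exit {k = k} short pm = exitOrRun k pm >>= λ where
    (inj₁ e)   → pure e
    (inj₂ run) → contradiction (short run) 1+n≰n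

  runEndingAt : ∀ {i} d → ¬ P i → P (i + d) → DoubleNegation (RunEndingAt P (i + d))
  runEndingAt {i} zero    ¬pi p = contradiction (subst P (+-identityʳ i) p) ¬pi
  runEndingAt {i} (suc d) ¬pi p = ¬¬-excluded-middle >>= λ where
    (no ¬p) → pure (i + d , 0 , trans (+-comm (i + d) 1) (sym (+-suc i d)) , ¬p ,
                    run-single (subst P (+-suc i d) p))
    (yes p′) → runEndingAt d ¬pi p′ >>= λ where
      (j , s , eq , ¬pj , run) →
        let eq′ = trans (cong suc eq) (sym (+-suc i d))
        in pure (j , suc s , trans (+-suc j (suc s)) eq′ , ¬pj ,
                 run-snoc run (subst P (sym eq′) p))

cPath-large : ∀ j → suc (suc j) ≤ cPath j
cPath-large zero    = ≤-refl
cPath-large (suc j) = +-monoˡ-≤ (suc (suc j)) (≤-trans (s≤s z≤n) (cPath-large j))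

cPath-mono : ∀ {m n} → m ≤ n → cPath m ≤ cPath n
cPath-mono {n = zero} z≤n = ≤-refl
cPath-mono {m} {suc n} m≤1+n with m≤n⇒m<n∨m≡n m≤1+n
... | inj₁ (s≤s m≤n) = ≤-trans (cPath-mono m≤n) (m≤m+n (cPath n) (suc (suc n)))
... | inj₂ refl      = ≤-refl

spokes : ℕ → ℕ → List Edge
spokes a = applyUpTo (spoke ∘ (a +_))

spoke-injective : ∀ {i j} → spoke i ≡ spoke j → i ≡ j
spoke-injective refl = refl

spokes-unique : ∀ a s → Unique (spokes a s)
spokes-unique a s = Uniqueₚ.applyUpTo⁺₁ _ s
  (λ i<j _ eq → <⇒≢ (+-monoʳ-< a i<j) (spoke-injective eq))

spokes-cost : ∀ (f : ℕ → ℕ) s → cost (applyUpTo (spoke ∘ f) s) ≡ s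
spokes-cost f zero    = refl
spokes-cost f (suc s) = cong suc (spokes-cost (f ∘ suc) s)

path∉spokes : ∀ j a s → All (path j ≢_) (spokes a s)
path∉spokes j a s = Allₚ.applyUpTo⁺₁ _ s (λ _ ())

-- d_c(I_N) ≤ K N for the initial segment I_N = {v_0,…,v_N}: its crossing
-- edges are e_N and the spokes at v_0,…,v_N.
K : ℕ → ℕ
K N = cPath N + suc N

initialSegment : ℕ → VSet
initialSegment N (v i) = i ≤ N
initialSegment N v∞    = ⊥

initialSegment-crossing : ∀ N {e} → Crossing (initialSegment N) e → e ∈ path N ∷ spokes 0 (suc N)
initialSegment-crossing N {spoke i} (inj₁ (() , _))
initialSegment-crossing N {spoke i} (inj₂ (_ , i≤N)) = there (∈-applyUpTo⁺ (spoke ∘ (0 +_)) (s≤s i≤N))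
initialSegment-crossing N {path i}  (inj₁ (i≤N , i≮N)) =
  here (cong path (≤-antisym i≤N (≮⇒≥ i≮N)))
initialSegment-crossing N {path i}  (inj₂ (i≰N , i<N)) = contradiction (<⇒≤ i<N) i≰N

initialSegment-cost : ∀ N → DcLe (initialSegment N) (K N)
initialSegment-cost N es ues crossing =
  ≤-trans (weight-⊆ c ues (initialSegment-crossing N ∘ All.lookup crossing))
          (≤-reflexive (cong (cPath N +_) (spokes-cost (0 +_) (suc N))))

module CutCosts (A : VSet) (v∞∉A : ¬ A v∞) {k : ℕ} (dA : DcLe A k) where

  -- A cut avoiding v_∞ contains no run longer than d_c(A), by its spokes.
  shortRuns : ∀ {a s} → Run (A ∘ v) a s → s ≤ k
  shortRuns {a} {s} run = subst (_≤ k) (spokes-cost (a +_) s)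
    (dA (spokes a s) (spokes-unique a s)
        (Allₚ.applyUpTo⁺₁ _ s (λ {t} t<s → inj₂ (v∞∉A , run t t<s))))

  exitAbove : ∀ {m} → A (v m) → DoubleNegation (Exit (A ∘ v) m)
  exitAbove = exit shortRuns

  exitCost : ∀ {j} → A (v j) → ¬ A (v (suc j)) → cPath j ≤ k
  exitCost {j} in₁ out₂ = subst (_≤ k) (+-identityʳ (cPath j))
    (dA (path j ∷ []) ([] ∷ []) (inj₁ (in₁ , out₂) ∷ []))

  -- A gap at v_j, the run v_{j+1},…,v_{j+s+1} in A and an exit e_{j'} with
  -- j < j' give the crossing edges e_j, e_{j'} and s+1 spokes.
  gapCost : ∀ {j s j'} → j < j' → ¬ A (v j) → Run (A ∘ v) (suc j) (suc s) →
            A (v j') → ¬ A (v (suc j')) → cPath j + (cPath j' + suc s) ≤ k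
  gapCost {j} {s} {j'} j<j' gap run in′ out′ =
    subst (_≤ k) (cong (λ x → cPath j + (cPath j' + x)) (spokes-cost (suc j +_) (suc s)))
      (dA (path j ∷ path j' ∷ spokes (suc j) (suc s))
          (((λ eq → <⇒≢ j<j' (path-injective eq)) ∷ path∉spokes j _ _)
             ∷ path∉spokes j' _ _ ∷ spokes-unique (suc j) (suc s))
          (inj₂ (gap , run-first {P = A ∘ v} run) ∷ inj₁ (in′ , out′)
             ∷ Allₚ.applyUpTo⁺₁ _ (suc s) (λ {t} t<s → inj₂ (v∞∉A , run t t<s))))
    where
    path-injective : ∀ {i i'} → path i ≡ path i' → i ≡ i'
    path-injective refl = refl

-- A low cut at level N: a v_N-v_∞ cut no more expensive than I_N.
record LowCut (N : ℕ) (A : VSet) : Set where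
  field
    contains : A (v N)
    avoids   : ¬ A v∞
    cheap    : DcLe A (K N)

module _ {N : ℕ} {A : VSet} (low : LowCut N A) where
  open LowCut low
  open CutCosts A avoids cheap

  -- (1) A low cut at level N misses v_{N+1}: its exit e_j has c(e_j) > K N.
  lowCut-excludes-next : ¬ A (v (suc N))
  lowCut-excludes-next in₁ = exitAbove in₁ λ where
    (j , N<j , in′ , out′) → contradiction
      (≤-trans (cPath-mono N<j) (exitCost in′ out′))
      (<⇒≱ (≤-reflexive (sym (+-suc (cPath N) (suc N)))))

  lowCut-contains-below : ∀ {i} → i ≤ N → DoubleNegation (A (v i))
  lowCut-contains-below {i} i≤N i∉A with d , refl ← m≤n⇒∃[o]m+o≡n i≤N =
    runEndingAt {P = A ∘ v} d i∉A contains λ where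
      (j , s , ends , gap , run) → exitAbove contains λ where
        (j' , N≤j' , in′ , out′) → contradiction
          (gapCost (<-≤-trans (subst (j <_) ends (m<m+n j (s≤s z≤n))) N≤j') gap run in′ out′)
          (<⇒≱ (tooExpensive j s ends N≤j'))
    where
    open +-*-Solver
    tooExpensive : ∀ j s {M j'} → j + suc s ≡ M → M ≤ j' → K M < cPath j + (cPath j' + suc s)
    tooExpensive j s refl M≤j' = ≤-trans
      (≤-reflexive (solve 3 (λ X j s → con 1 :+ (X :+ (con 1 :+ (j :+ (con 1 :+ s))))
                                    := con 2 :+ j :+ (X :+ (con 1 :+ s)))
                          refl (cPath (j + suc s)) j s))
      (+-mono-≤ (cPath-large j) (+-monoˡ-≤ (suc s) (cPath-mono M≤j')))

_≟V_ : (x y : V) → Dec (x ≡ y)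
v i ≟V v j = map′ (cong v) (λ { refl → refl }) (i ≟ j)
v i ≟V v∞  = no λ ()
v∞  ≟V v j = no λ ()
v∞  ≟V v∞  = yes refl

sameEdge? : ∀ a b x y → Dec (SameEdge a b x y)
sameEdge? a b x y = ((x ≟V a) ×-dec (y ≟V b)) ⊎-dec ((x ≟V b) ×-dec (y ≟V a))

module _ {E : Rel} where

  -- A walk from the a-side of ab to its outside traverses ab itself, so
  -- every property shared by all vertices of the walk holds at a and b.
  leavingSide : ∀ {P : V → Set} {a b} x xs → All P (x ∷ xs) → Side E a b x →
                Chain E x xs → ¬ Side E a b (last x xs) → P a × P b
  leavingSide x [] _ inside _ outside = contradiction inside outside
  leavingSide {a = a} {b} x (y ∷ ys) (px ∷ py ∷ ps) inside (xy ∷ᶜ chain) outside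
    with sameEdge? a b x y
  ... | yes (inj₁ (refl , refl)) = px , py
  ... | yes (inj₂ (refl , refl)) = py , px
  ... | no ¬ab = leavingSide y ys (py ∷ ps) (step inside xy ¬ab) chain outside

  side-⊆ : ∀ {a b a' b'} → DoubleNegation (Side E a b a') →
           (Side E a' b' b → DoubleNegation (Side E a b b)) →
           ∀ {x} → Side E a' b' x → DoubleNegation (Side E a b x)
  side-⊆ a'∈ b∈ Side.here = a'∈
  side-⊆ {a} {b} a'∈ b∈ (step {y} {z} y∈ yz ¬a'b') with sameEdge? a b y z
  ... | no ¬ab                 = do y∈S ← side-⊆ a'∈ b∈ y∈; pure (step y∈S yz ¬ab)
  ... | yes (inj₂ (_ , refl))  = pure Side.here
  ... | yes (inj₁ (_ , refl))  = b∈ (step y∈ yz ¬a'b')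

  record SeparatingSide (N : ℕ) : Set₁ where
    field
      a b : V
      low : LowCut N (Side E a b)

  separatingSide : IsGomoryHu E → ∀ N → SeparatingSide N
  separatingSide gh N with a , b , _ , _ , _ , (vN∈ , v∞∉) , minimal ← gh (v N) v∞ (λ ()) =
    record { a = a ; b = b ; low = record
      { contains = vN∈ ; avoids = v∞∉
      ; cheap = minimal (initialSegment N) (≤-refl , λ ()) (K N) (initialSegment-cost N) } }

  separatingEdge-onPath : ∀ {M} {P : V → Set} xs → All P (v 0 ∷ xs) → Chain E (v 0) xs →
    last (v 0) xs ≡ v∞ → (S : SeparatingSide M) →
    DoubleNegation (P (SeparatingSide.a S) × P (SeparatingSide.b S))
  separatingEdge-onPath xs onP chain ends S = do
    v₀∈ ← lowCut-contains-below low z≤n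
    pure (leavingSide (v 0) xs onP v₀∈ chain (LowCut.avoids low ∘ subst (Side E a b) ends))
    where open SeparatingSide S

data Below (N : ℕ) : V → Set where
  infinite : Below N v∞
  finite   : ∀ {i} → i < N → Below N (v i)

below-weaken : ∀ {M N x} → M ≤ N → Below M x → Below N x
below-weaken _   infinite     = infinite
below-weaken M≤N (finite i<M) = finite (<-≤-trans i<M M≤N)

indexBound : List V → ℕ
indexBound []         = 0
indexBound (v i ∷ xs) = suc i + indexBound xs
indexBound (v∞ ∷ xs)  = indexBound xs

indexBound-bounds : ∀ xs → All (Below (indexBound xs)) xs
indexBound-bounds []         = []
indexBound-bounds (v i ∷ xs) = finite (s≤s (m≤m+n i _))
  ∷ All.map (below-weaken (m≤n+m _ (suc i))) (indexBound-bounds xs)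
indexBound-bounds (v∞ ∷ xs)  = infinite ∷ indexBound-bounds xs

below-in-lowCut : ∀ {N M A B x} → LowCut N A → LowCut M B → Below N x → B x → DoubleNegation (A x)
below-in-lowCut low lowB infinite     v∞∈B = contradiction v∞∈B (LowCut.avoids lowB)
below-in-lowCut low lowB (finite i<N) _    = lowCut-contains-below low (<⇒≤ i<N)

mainTheorem16 : (E : V → V → Set) → ¬ GomoryHuTree E
mainTheorem16 E (tree , gh) with xs , chain , _ , ends ← IsTree.connected tree (v 0) v∞ =
  absurd (λ ())
  where
  -- N exceeds every index on the tree path from v_0 to v_∞.
  N = indexBound (v 0 ∷ xs)
  S  = separatingSide gh N
  S′ = separatingSide gh (suc N)
  low  = SeparatingSide.low S
  low′ = SeparatingSide.low S′

  onPath : ∀ {M} (T : SeparatingSide {E} M) →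
           DoubleNegation (Below N (SeparatingSide.a T) × Below N (SeparatingSide.b T))
  onPath = separatingEdge-onPath xs (indexBound-bounds (v 0 ∷ xs)) chain ends

  -- The side of S′ is contained in that of S, yet v_{N+1} lies only in the former.
  absurd : DoubleNegation ⊥
  absurd = do
    (a′-below , _) ← onPath S′
    (_ , b-below)  ← onPath S
    vN+1∈S ← side-⊆ (below-in-lowCut low low′ a′-below Side.here)
                    (below-in-lowCut low low′ b-below)
                    (LowCut.contains low′)
    pure (lowCut-excludes-next low vN+1∈S)
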